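{- Let $X$ be a nonempty set of choice functions for $L$ such that $\varphi|(\psi|\sigma)\sim_X(\varphi|\psi)|\sigma$ for all $\varphi,\psi,\sigma\in Sen(L_s)$. Then every $f\in X$ is essentially associative.
   Context: Let $L$ be the propositional language with atoms $p_0,p_1,\ldots$ and connectives $\neg,\wedge$ (others defined as usual); $L_s$ adds a primitive binary connective $|$. $\sim$ denotes classical logical equivalence of $L$-sentences. A truth assignment $M$ is a classical valuation of $Sen(L)$. A choice function for $L$ is a map $f$ assigning to each set $\{\alpha,\beta\}$ of $L$-sentences (possibly $\alpha=\beta$) an element $f(\alpha,\beta)\in\{\alpha,\beta\}$; it is essentially associative if $f(f(\alpha,\beta),\gamma)\sim f(\alpha,f(\beta,\gamma))$ for all $\alpha,\beta,\gamma\in Sen(L)$. Each $f$ induces $\overline f:Sen(L_s)\to Sen(L)$: $\overline f(\alpha)=\alpha$ for classical $\alpha$, $\overline f$ commutes with $\neg,\wedge$, and $\overline f(\varphi|\psi)=f(\overline f(\varphi),\overline f(\psi))$. $\langle M,f\rangle\models_s\varphi$ iff $M\models\overline f(\varphi)$. $\varphi\sim_X\psi$ means: for every $M$ and every $f\in X$, $\langle M,f\rangle\models_s\varphi\iff\langle M,f\rangle\models_s\psi$. -}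

module Defs where

open import Data.Nat using (ℕ)
open import Data.Bool using (Bool; not; _∧_)
open import Data.Sum using (_⊎_)
open import Data.Product using (_×_)
open import Relation.Binary.PropositionalEquality using (_≡_)

data Sen : Set where
  atom : ℕ → Sen
  ¬'   : Sen → Sen
  _∧'_ : Sen → Sen → Sen

data SenS : Set where
  atomS : ℕ → SenS
  ¬S    : SenS → SenS
  _∧S_  : SenS → SenS → SenS
  _∣S_  : SenS → SenS → SenS

Assignment : Set
Assignment = ℕ → Bool

⟦_⟧ : Sen → Assignment → Bool
⟦ atom i ⟧ M = M i
⟦ ¬' a ⟧ M = not (⟦ a ⟧ M)
⟦ a ∧' b ⟧ M = ⟦ a ⟧ M ∧ ⟦ b ⟧ M

_⊨_ : Assignment → Sen → Set
M ⊨ a = ⟦ a ⟧ M ≡ Data.Bool.true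

_∼_ : Sen → Sen → Set
a ∼ b = ∀ (M : Assignment) → ⟦ a ⟧ M ≡ ⟦ b ⟧ M

-- A choice function: assigns to each unordered pair {α,β} an element of it.
-- Represented as a binary operation that is symmetric (so it depends only on the set {α,β})
-- and selective.
record ChoiceFn : Set where
  field
    choose    : Sen → Sen → Sen
    selective : ∀ a b → (choose a b ≡ a) ⊎ (choose a b ≡ b)
    symmetric : ∀ a b → choose a b ≡ choose b a
open ChoiceFn public

EssentiallyAssociative : ChoiceFn → Set
EssentiallyAssociative f =
  ∀ a b c → choose f (choose f a b) c ∼ choose f a (choose f b c)

-- the induced translation  f̄ : Sen(L_s) → Sen(L)
-- (classical sentences are the |-free ones; f̄ is the identity on them)
bar : ChoiceFn → SenS → Sen
bar f (atomS i) = atom i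
bar f (¬S φ) = ¬' (bar f φ)
bar f (φ ∧S ψ) = bar f φ ∧' bar f ψ
bar f (φ ∣S ψ) = choose f (bar f φ) (bar f ψ)

Sat : Assignment → ChoiceFn → SenS → Set
Sat M f φ = M ⊨ bar f φ

EquivX : (ChoiceFn → Set) → SenS → SenS → Set
EquivX X φ ψ = ∀ (M : Assignment) (f : ChoiceFn) → X f →
  (Sat M f φ → Sat M f ψ) × (Sat M f ψ → Sat M f φ)

{-# OPTIONS --safe #-}
module Submission where

open import Defs
open import Data.Product using (∃; _,_)
open import Data.Bool.Properties using (⇔→≡)
open import Function.Bundles using (mk⇔)
open import Relation.Binary.PropositionalEquality
  using (_≡_; refl; cong; cong₂; module ≡-Reasoning)

-- Instantiate the hypothesis at classical sentences α, β, γ: f̄ is the identity on them,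
-- so f̄ maps the two sides to f(α,f(β,γ)) and f(f(α,β),γ), which are therefore satisfied
-- by the same assignments.

embed : Sen → SenS
embed (atom i) = atomS i
embed (¬' a)   = ¬S (embed a)
embed (a ∧' b) = embed a ∧S embed b

bar-embed : ∀ f a → bar f (embed a) ≡ a
bar-embed f (atom i) = refl
bar-embed f (¬' a)   = cong ¬' (bar-embed f a)
bar-embed f (a ∧' b) = cong₂ _∧'_ (bar-embed f a) (bar-embed f b)

EquivX⇒bar-∼ : ∀ {X f} φ ψ → EquivX X φ ψ → X f → bar f φ ∼ bar f ψ
EquivX⇒bar-∼ φ ψ φ≈ψ Xf M with φ≈ψ M _ Xf
... | φ⇒ψ , ψ⇒φ = ⇔→≡ (mk⇔ φ⇒ψ ψ⇒φ)

theorem2p21 : (X : ChoiceFn → Set) → ∃ X →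
    (∀ φ ψ σ → EquivX X (φ ∣S (ψ ∣S σ)) ((φ ∣S ψ) ∣S σ)) →
    ∀ f → X f → EssentiallyAssociative f
theorem2p21 X _ assoc f Xf a b c M = begin
  ⟦ ∣f (∣f a b) c ⟧ M         ≡⟨ cong (λ u → ⟦ u ⟧ M) bar-left ⟨
  ⟦ bar f ((α ∣S β) ∣S γ) ⟧ M  ≡⟨ EquivX⇒bar-∼ (α ∣S (β ∣S γ)) ((α ∣S β) ∣S γ) (assoc α β γ) Xf M ⟨
  ⟦ bar f (α ∣S (β ∣S γ)) ⟧ M  ≡⟨ cong (λ u → ⟦ u ⟧ M) bar-right ⟩
  ⟦ ∣f a (∣f b c) ⟧ M         ∎
  where
  open ≡-Reasoning
  ∣f = choose f
  α = embed a
  β = embed b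
  γ = embed c
  bar-left : bar f ((α ∣S β) ∣S γ) ≡ ∣f (∣f a b) c
  bar-left = cong₂ ∣f (cong₂ ∣f (bar-embed f a) (bar-embed f b)) (bar-embed f c)
  bar-right : bar f (α ∣S (β ∣S γ)) ≡ ∣f a (∣f b c)
  bar-right = cong₂ ∣f (bar-embed f a) (cong₂ ∣f (bar-embed f b) (bar-embed f c))
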